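{- The prevariety $\mathcal{TBP}_2$ is not finitely based; that is, there is no $m\geq 1$ such that every finite simplicial complex not in $\mathcal{TBP}_2$ has a restriction with at most $m$ vertices that is not in $\mathcal{TBP}_2$.
   Context: A (finite) simplicial complex is a pair $S=(V,\mathcal{H})$ where $V$ is a finite nonempty set and $\mathcal{H}\subseteq 2^V$ contains all singletons and is closed under taking subsets. Its dimension is $\max\{|I|:I\in\mathcal{H}\}-1$. $P_n(V)$ (resp. $P_{\leq n}(V)$) is the set of subsets of $V$ of size exactly (resp. at most) $n$. $S$ is paving if $P_{\dim S}(V)\subseteq\mathcal{H}$. For nonempty $W\subseteq V$ the restriction is $S|_W=(W,\mathcal{H}\cap 2^W)$. $S$ is boolean representable (BRSC) if there is a boolean matrix $M$ with columns indexed by $V$ such that $\mathcal{H}$ is exactly the set of $X\subseteq V$ for which some square submatrix with column set $X$ is congruent (by permuting rows and columns) to a lower unitriangular boolean matrix. For $k\geq 1$, $T_k(S)=(V,\mathcal{H}\cap P_{\leq k}(V))$; $S$ is a TBRSC if $S=T_k(S')$ for some BRSC $S'$ and $k\geq1$. $\mathcal{TBP}_2$ is the class of all finite simplicial complexes of dimension at most $2$ which are paving and TBRSCs; it is closed under isomorphism and restriction (a prevariety). -}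

module Defs where

open import Data.Nat using (ℕ; zero; suc; _≤_; _≤?_; _+_)
open import Data.Bool using (Bool; true; false; _∧_)
open import Data.Fin using (Fin) renaming (_<_ to _<ᶠ_)
open import Data.Fin.Subset using (Subset; ⁅_⁆; _∪_; ∣_∣; _∈_; _⊆_) renaming (⊥ to ∅)
open import Data.Vec using (_∷_; [])
open import Data.Product using (Σ; _×_; ∃)
open import Relation.Binary.PropositionalEquality using (_≡_)
open import Relation.Nullary.Decidable using (⌊_⌋)
open import Function.Definitions using (Injective)
open import Function.Bundles using (_⇔_)

Faces : ℕ → Set
Faces n = Subset n → Bool

record IsSC {n : ℕ} (F : Faces n) : Set where
  field
    singletons : ∀ v → F ⁅ v ⁆ ≡ true
    downClosed : ∀ X Y → Y ⊆ X → F X ≡ true → F Y ≡ true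

DimLe2 : {n : ℕ} → Faces n → Set
DimLe2 F = ∀ X → F X ≡ true → ∣ X ∣ ≤ 3

-- paving: if I is a face of maximum size (so dim = |I| - 1), then every
-- subset X of V with |X| = dim is a face.
Paving : {n : ℕ} → Faces n → Set
Paving F = ∀ I → F I ≡ true → (∀ J → F J ≡ true → ∣ J ∣ ≤ ∣ I ∣) →
           ∀ X → suc ∣ X ∣ ≡ ∣ I ∣ → F X ≡ true

-- The column set X of the boolean matrix M (r rows, columns Fin n) admits a
-- square submatrix congruent to a lower unitriangular matrix: an injective
-- choice of k rows ρ and an injective enumeration σ of X (columns) such that
-- the diagonal entries are 1 and entries above the diagonal are 0.
Triangular : {r n : ℕ} → (Fin r → Fin n → Bool) → Subset n → Set
Triangular {r} {n} M X =
  Σ ℕ λ k → Σ (Fin k → Fin r) λ ρ → Σ (Fin k → Fin n) λ σ →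
    Injective _≡_ _≡_ ρ × Injective _≡_ _≡_ σ ×
    (∀ v → (v ∈ X) ⇔ (∃ λ j → σ j ≡ v)) ×
    (∀ j → M (ρ j) (σ j) ≡ true) ×
    (∀ j l → j <ᶠ l → M (ρ j) (σ l) ≡ false)

IsBRSC : {n : ℕ} → Faces n → Set
IsBRSC {n} F = IsSC F × Σ ℕ λ r → Σ (Fin r → Fin n → Bool) λ M →
  ∀ X → (F X ≡ true) ⇔ Triangular M X

Trunc : {n : ℕ} → ℕ → Faces n → Faces n
Trunc k F X = F X ∧ ⌊ ∣ X ∣ ≤? k ⌋

IsTBRSC : {n : ℕ} → Faces n → Set
IsTBRSC {n} F = Σ ℕ λ k → 1 ≤ k × Σ (Faces n) λ F' → IsBRSC F' × (∀ X → F X ≡ Trunc k F' X)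

InTBP2 : {n : ℕ} → Faces n → Set
InTBP2 F = IsSC F × DimLe2 F × Paving F × IsTBRSC F

image : {k n : ℕ} → (Fin k → Fin n) → Subset k → Subset n
image {zero} f [] = ∅
image {suc k} f (true ∷ X) = ⁅ f Fin.zero ⁆ ∪ image (λ i → f (Fin.suc i)) X
image {suc k} f (false ∷ X) = image (λ i → f (Fin.suc i)) X

-- restriction of F to the image of an injective map f : Fin k → Fin n,
-- transported to vertex set Fin k (isomorphic to S|_{im f})
restrictAlong : {k n : ℕ} → (Fin k → Fin n) → Faces n → Faces k
restrictAlong f F X = F (image f X)

-- For L ≥ 0 let Δ be the complex on the vertices 0, …, 7 + L whose faces are the sets of at most
-- three vertices containing none of the nonfaces {i, i + 1, i + 2} and {a, 6 + L, 7 + L} with a ≤ 1.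
--
-- Δ is not a TBRSC. If Δ = T_k(S) with S represented by a boolean matrix M, the face {0, 1, 7 + L}
-- forces k ≥ 3, and the first row of a triangular witness for it is 1 at one of these vertices and 0
-- at the other two. No row is 0 at two vertices of a nonface and 1 at the third, since the nonface
-- would then be triangular, hence a face; so the zeros of that row spread along the nonfaces until
-- they reach the vertex where it is 1.
--
-- Every restriction missing a vertex v is in TBP₂: it is the 3-truncation of the BRSC represented by
-- the rows "all ones", "w ≥ v", and, for each pair {a, b} lying in no nonface that avoids v, the
-- complement of {a, b}. None of these rows isolates a vertex of a nonface avoiding v from the other
-- two, while a face all of whose pairs do lie in such nonfaces has two vertices in {0, 1} and one in
-- {6 + L, 7 + L} above v, which the row "w ≥ v" isolates. Restrictions to at most 7 + L vertices
-- miss a vertex, so L = m refutes the bound m.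

module Submission where

open import Defs
open import Data.Nat as ℕ using (ℕ; zero; suc; _+_; _*_; _≤_; _<_; z≤n; s≤s)
import Data.Nat.Properties as ℕ
open import Data.Bool as Bool using (Bool; true; false; _∧_; not)
open import Data.Bool.Properties using (¬-not)
open import Data.Fin as Fin using (Fin; toℕ) renaming (_<_ to _<ᶠ_)
import Data.Fin.Properties as Fin
open import Data.Fin.Subset using (Subset; ⁅_⁆; _∪_; ∣_∣; _∈_; _∉_; _⊆_; _─_; _-_; Empty; Nonempty)
  renaming (⊥ to ∅)
open import Data.Fin.Subset.Properties
  using (x∈⁅x⁆; x∈⁅y⁆⇒x≡y; ∣⁅x⁆∣≡1; x∈p∪q⁺; x∈p∪q⁻; ∪-identityˡ; ∪-identityʳ; ∣⊥∣≡0; ∉⊥; ⊆-antisym;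
         p⊆q⇒∣p∣≤∣q∣; x∈p∧x≢y⇒x∈p-y; p─q⊆p; x∈p⇒∣p-x∣<∣p∣; _∈?_; nonempty?)
open import Data.Vec using (_∷_; []; here; there)
open import Data.Vec.Functional using () renaming (_∷_ to _∷ᶠ_)
open import Data.Product using (Σ; _×_; ∃; _,_; proj₁; proj₂)
open import Data.Sum as Sum using (_⊎_; inj₁; inj₂; [_,_]; [_,_]′)
open import Data.Empty using (⊥; ⊥-elim)
open import Data.Unit using (⊤; tt)
open import Relation.Nullary using (¬_; Dec; yes; no; contradiction; ¬?)
open import Relation.Binary.Definitions using (tri<; tri≈; tri>)
open import Relation.Nullary.Decidable using (⌊_⌋; map′; _×-dec_; _⊎-dec_; _→-dec_)
open import Relation.Binary.PropositionalEquality
  using (_≡_; _≢_; refl; sym; trans; cong; cong₂; subst; module ≡-Reasoning)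
open import Function.Base using (_∘_; id)
open import Function.Definitions using (Injective)
open import Function.Bundles using (_⇔_; mk⇔; Equivalence)

private
  variable
    k m n : ℕ

-- Finite subsets

pair : Fin n → Fin n → Subset n
pair x y = ⁅ x ⁆ ∪ ⁅ y ⁆

triple : Fin n → Fin n → Fin n → Subset n
triple x y z = ⁅ x ⁆ ∪ pair y z

∈-⁅⁆∪⁻ : ∀ {x w : Fin n} (p : Subset n) → w ∈ ⁅ x ⁆ ∪ p → w ≡ x ⊎ w ∈ p
∈-⁅⁆∪⁻ {x = x} p w∈ with x∈p∪q⁻ ⁅ x ⁆ p w∈
... | inj₁ w∈x = inj₁ (x∈⁅y⁆⇒x≡y x w∈x)
... | inj₂ w∈p = inj₂ w∈p

∈-pair⁻ : ∀ {x y w : Fin n} → w ∈ pair x y → w ≡ x ⊎ w ≡ y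
∈-pair⁻ {y = y} w∈ with ∈-⁅⁆∪⁻ ⁅ y ⁆ w∈
... | inj₁ w≡x = inj₁ w≡x
... | inj₂ w∈y = inj₂ (x∈⁅y⁆⇒x≡y y w∈y)

∈-triple⁻ : ∀ {x y z w : Fin n} → w ∈ triple x y z → w ≡ x ⊎ w ≡ y ⊎ w ≡ z
∈-triple⁻ {y = y} {z} w∈ with ∈-⁅⁆∪⁻ (pair y z) w∈
... | inj₁ w≡x = inj₁ w≡x
... | inj₂ w∈yz = inj₂ (∈-pair⁻ w∈yz)

x∈⁅x⁆∪p : (x : Fin n) (p : Subset n) → x ∈ ⁅ x ⁆ ∪ p
x∈⁅x⁆∪p x p = x∈p∪q⁺ (inj₁ (x∈⁅x⁆ x))

∈⁅x⁆∪p : ∀ {w} (x : Fin n) {p : Subset n} → w ∈ p → w ∈ ⁅ x ⁆ ∪ p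
∈⁅x⁆∪p x w∈p = x∈p∪q⁺ (inj₂ w∈p)

x∈pair : (x y : Fin n) → x ∈ pair x y
x∈pair x y = x∈⁅x⁆∪p x ⁅ y ⁆

y∈pair : (x y : Fin n) → y ∈ pair x y
y∈pair x y = ∈⁅x⁆∪p x (x∈⁅x⁆ y)

x∈triple : (x y z : Fin n) → x ∈ triple x y z
x∈triple x y z = x∈⁅x⁆∪p x (pair y z)

y∈triple : (x y z : Fin n) → y ∈ triple x y z
y∈triple x y z = ∈⁅x⁆∪p x (x∈pair y z)

z∈triple : (x y z : Fin n) → z ∈ triple x y z
z∈triple x y z = ∈⁅x⁆∪p x (y∈pair y z)

⁅x⁆∪p⊆q : ∀ {x : Fin n} {p q : Subset n} → x ∈ q → p ⊆ q → ⁅ x ⁆ ∪ p ⊆ q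
⁅x⁆∪p⊆q x∈q p⊆q w∈ with ∈-⁅⁆∪⁻ _ w∈
... | inj₁ refl = x∈q
... | inj₂ w∈p = p⊆q w∈p

p≡⁅x⁆∪p-x : ∀ {x : Fin n} {p : Subset n} → x ∈ p → p ≡ ⁅ x ⁆ ∪ (p - x)
p≡⁅x⁆∪p-x {x = x} {p} x∈p = ⊆-antisym split (⁅x⁆∪p⊆q x∈p (p─q⊆p p ⁅ x ⁆))
  where
  split : p ⊆ ⁅ x ⁆ ∪ (p - x)
  split {w} w∈p with w Fin.≟ x
  ... | yes refl = x∈⁅x⁆∪p x (p - x)
  ... | no w≢x = ∈⁅x⁆∪p x (x∈p∧x≢y⇒x∈p-y w∈p w≢x)

⁅x⁆⊆p : ∀ {x : Fin n} {p : Subset n} → x ∈ p → ⁅ x ⁆ ⊆ p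
⁅x⁆⊆p {x = x} x∈p w∈ = subst (_∈ _) (sym (x∈⁅y⁆⇒x≡y x w∈)) x∈p

x∈p─q⇒x∉q : ∀ {x : Fin n} (p q : Subset n) → x ∈ p ─ q → x ∉ q
x∈p─q⇒x∉q (_ ∷ p) (true ∷ q) (there x∈) (there x∈q) = x∈p─q⇒x∉q p q x∈ x∈q
x∈p─q⇒x∉q (_ ∷ p) (false ∷ q) (there x∈) (there x∈q) = x∈p─q⇒x∉q p q x∈ x∈q

x∈p-y⇒x≢y : ∀ {x y : Fin n} (p : Subset n) → x ∈ p - y → x ≢ y
x∈p-y⇒x≢y {y = y} p x∈ refl = x∈p─q⇒x∉q p ⁅ y ⁆ x∈ (x∈⁅x⁆ y)

∣⁅x⁆∪p∣≤1+∣p∣ : (x : Fin n) (p : Subset n) → ∣ ⁅ x ⁆ ∪ p ∣ ≤ suc ∣ p ∣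
∣⁅x⁆∪p∣≤1+∣p∣ Fin.zero (false ∷ p) = s≤s (ℕ.≤-reflexive (cong ∣_∣ (∪-identityˡ p)))
∣⁅x⁆∪p∣≤1+∣p∣ Fin.zero (true ∷ p) = s≤s (ℕ.m≤n⇒m≤1+n (ℕ.≤-reflexive (cong ∣_∣ (∪-identityˡ p))))
∣⁅x⁆∪p∣≤1+∣p∣ (Fin.suc x) (false ∷ p) = ∣⁅x⁆∪p∣≤1+∣p∣ x p
∣⁅x⁆∪p∣≤1+∣p∣ (Fin.suc x) (true ∷ p) = s≤s (∣⁅x⁆∪p∣≤1+∣p∣ x p)

∣⁅x⁆∪p∣≡1+∣p∣ : (x : Fin n) (p : Subset n) → x ∉ p → ∣ ⁅ x ⁆ ∪ p ∣ ≡ suc ∣ p ∣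
∣⁅x⁆∪p∣≡1+∣p∣ Fin.zero (true ∷ p) x∉p = contradiction here x∉p
∣⁅x⁆∪p∣≡1+∣p∣ Fin.zero (false ∷ p) x∉p = cong suc (cong ∣_∣ (∪-identityˡ p))
∣⁅x⁆∪p∣≡1+∣p∣ (Fin.suc x) (true ∷ p) x∉p = cong suc (∣⁅x⁆∪p∣≡1+∣p∣ x p (λ x∈p → x∉p (there x∈p)))
∣⁅x⁆∪p∣≡1+∣p∣ (Fin.suc x) (false ∷ p) x∉p = ∣⁅x⁆∪p∣≡1+∣p∣ x p (λ x∈p → x∉p (there x∈p))

∣pair∣≤2 : (x y : Fin n) → ∣ pair x y ∣ ≤ 2
∣pair∣≤2 x y = ℕ.≤-trans (∣⁅x⁆∪p∣≤1+∣p∣ x ⁅ y ⁆) (ℕ.≤-reflexive (cong suc (∣⁅x⁆∣≡1 y)))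

∣triple∣≤3 : (x y z : Fin n) → ∣ triple x y z ∣ ≤ 3
∣triple∣≤3 x y z = ℕ.≤-trans (∣⁅x⁆∪p∣≤1+∣p∣ x (pair y z)) (s≤s (∣pair∣≤2 y z))

∣triple∣≡3 : ∀ {x y z : Fin n} → x ≢ y → x ≢ z → y ≢ z → ∣ triple x y z ∣ ≡ 3
∣triple∣≡3 {x = x} {y} {z} x≢y x≢z y≢z = begin
  ∣ triple x y z ∣ ≡⟨ ∣⁅x⁆∪p∣≡1+∣p∣ x (pair y z) x∉yz ⟩
  suc ∣ pair y z ∣ ≡⟨ cong suc (∣⁅x⁆∪p∣≡1+∣p∣ y ⁅ z ⁆ (λ y∈z → y≢z (x∈⁅y⁆⇒x≡y z y∈z))) ⟩
  suc (suc ∣ ⁅ z ⁆ ∣) ≡⟨ cong (λ c → suc (suc c)) (∣⁅x⁆∣≡1 z) ⟩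
  3 ∎
  where
  open ≡-Reasoning
  x∉yz : x ∉ pair y z
  x∉yz x∈ with ∈-pair⁻ x∈
  ... | inj₁ x≡y = x≢y x≡y
  ... | inj₂ x≡z = x≢z x≡z

triple⊆p : ∀ {x y z : Fin n} {p : Subset n} → x ∈ p → y ∈ p → z ∈ p → triple x y z ⊆ p
triple⊆p x∈p y∈p z∈p = ⁅x⁆∪p⊆q x∈p (⁅x⁆∪p⊆q y∈p (⁅x⁆⊆p z∈p))

triple-swap : (x y z : Fin n) → triple y x z ≡ triple x y z
triple-swap x y z =
  ⊆-antisym (triple⊆p (y∈triple x y z) (x∈triple x y z) (z∈triple x y z))
            (triple⊆p (y∈triple y x z) (x∈triple y x z) (z∈triple y x z))

triple-rotate : (x y z : Fin n) → triple z x y ≡ triple x y z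
triple-rotate x y z =
  ⊆-antisym (triple⊆p (z∈triple x y z) (x∈triple x y z) (y∈triple x y z))
            (triple⊆p (y∈triple z x y) (z∈triple z x y) (x∈triple z x y))

3≤∣triple∣⇒distinct : ∀ {x y z : Fin n} → 3 ≤ ∣ triple x y z ∣ → x ≢ y × x ≢ z × y ≢ z
3≤∣triple∣⇒distinct {x = x} {y} {z} 3≤∣xyz∣ =
  (λ { refl → too-small (triple⊆p (x∈pair x z) (x∈pair x z) (y∈pair x z)) }) ,
  (λ { refl → too-small (triple⊆p (x∈pair x y) (y∈pair x y) (x∈pair x y)) }) ,
  (λ { refl → too-small (triple⊆p (x∈pair x y) (y∈pair x y) (y∈pair x y)) })
  where
  too-small : ∀ {a b} → triple x y z ⊆ pair a b → ⊥
  too-small {a} {b} xyz⊆ab = ℕ.<-irrefl refl (ℕ.≤-trans 3≤∣xyz∣ (ℕ.≤-trans (p⊆q⇒∣p∣≤∣q∣ xyz⊆ab) (∣pair∣≤2 a b)))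

distinct⇒3≤∣p∣ : ∀ {x y z : Fin n} {p : Subset n} → x ≢ y → x ≢ z → y ≢ z → x ∈ p → y ∈ p → z ∈ p → 3 ≤ ∣ p ∣
distinct⇒3≤∣p∣ x≢y x≢z y≢z x∈p y∈p z∈p =
  subst (_≤ _) (∣triple∣≡3 x≢y x≢z y≢z) (p⊆q⇒∣p∣≤∣q∣ (triple⊆p x∈p y∈p z∈p))

0<∣p∣⇒Nonempty : (p : Subset n) → 0 < ∣ p ∣ → Nonempty p
0<∣p∣⇒Nonempty (true ∷ p) _ = Fin.zero , here
0<∣p∣⇒Nonempty (false ∷ p) 0<∣p∣ with 0<∣p∣⇒Nonempty p 0<∣p∣
... | x , x∈p = Fin.suc x , there x∈p

∣p∣≡1+∣p-x∣ : ∀ {x : Fin n} {p : Subset n} → x ∈ p → ∣ p ∣ ≡ suc ∣ p - x ∣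
∣p∣≡1+∣p-x∣ {x = x} {p} x∈p =
  trans (cong ∣_∣ (p≡⁅x⁆∪p-x x∈p)) (∣⁅x⁆∪p∣≡1+∣p∣ x (p - x) (λ x∈ → x∈p-y⇒x≢y p x∈ refl))

∣p∣≡1+c⇒∣p-x∣≡c : ∀ {c} (p : Subset n) → ∣ p ∣ ≡ suc c → ∃ λ x → x ∈ p × ∣ p - x ∣ ≡ c
∣p∣≡1+c⇒∣p-x∣≡c p ∣p∣≡1+c with 0<∣p∣⇒Nonempty p (subst (0 <_) (sym ∣p∣≡1+c) (s≤s z≤n))
... | x , x∈p = x , x∈p , ℕ.suc-injective (trans (sym (∣p∣≡1+∣p-x∣ x∈p)) ∣p∣≡1+c)

∣p∣≡0⇒Empty : (p : Subset n) → ∣ p ∣ ≡ 0 → Empty p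
∣p∣≡0⇒Empty p ∣p∣≡0 (x , x∈p) with () ← trans (sym (∣p∣≡1+∣p-x∣ x∈p)) ∣p∣≡0

∣p∣≡1⇒singleton : (p : Subset n) → ∣ p ∣ ≡ 1 → ∃ λ x → p ≡ ⁅ x ⁆
∣p∣≡1⇒singleton p ∣p∣≡1 with ∣p∣≡1+c⇒∣p-x∣≡c p ∣p∣≡1
... | x , x∈p , ∣p-x∣≡0 = x , ⊆-antisym p⊆x (⁅x⁆⊆p x∈p)
  where
  p⊆x : p ⊆ ⁅ x ⁆
  p⊆x w∈p with ∈-⁅⁆∪⁻ (p - x) (subst (_ ∈_) (p≡⁅x⁆∪p-x x∈p) w∈p)
  ... | inj₁ refl = x∈⁅x⁆ x
  ... | inj₂ w∈p-x = ⊥-elim (∣p∣≡0⇒Empty (p - x) ∣p-x∣≡0 (_ , w∈p-x))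

∣p∣≡2⇒pair : (p : Subset n) → ∣ p ∣ ≡ 2 → ∃ λ x → ∃ λ y → x ≢ y × p ≡ pair x y
∣p∣≡2⇒pair p ∣p∣≡2 with ∣p∣≡1+c⇒∣p-x∣≡c p ∣p∣≡2
... | x , x∈p , ∣p-x∣≡1 with ∣p∣≡1⇒singleton (p - x) ∣p-x∣≡1
... | y , p-x≡y =
  x , y , (λ x≡y → x∈p-y⇒x≢y p y∈p-x (sym x≡y)) ,
  trans (p≡⁅x⁆∪p-x x∈p) (cong (⁅ x ⁆ ∪_) p-x≡y)
  where
  y∈p-x : y ∈ p - x
  y∈p-x = subst (y ∈_) (sym p-x≡y) (x∈⁅x⁆ y)

∣p∣≡3⇒triple : (p : Subset n) → ∣ p ∣ ≡ 3 →
               ∃ λ x → ∃ λ y → ∃ λ z → x ≢ y × x ≢ z × y ≢ z × p ≡ triple x y z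
∣p∣≡3⇒triple p ∣p∣≡3 with ∣p∣≡1+c⇒∣p-x∣≡c p ∣p∣≡3
... | x , x∈p , ∣p-x∣≡2 with ∣p∣≡2⇒pair (p - x) ∣p-x∣≡2
... | y , z , y≢z , p-x≡yz =
  x , y , z , (λ x≡y → ≢x (x∈pair y z) (sym x≡y)) , (λ x≡z → ≢x (y∈pair y z) (sym x≡z)) , y≢z ,
  trans (p≡⁅x⁆∪p-x x∈p) (cong (⁅ x ⁆ ∪_) p-x≡yz)
  where
  ≢x : ∀ {w} → w ∈ pair y z → w ≢ x
  ≢x w∈ = x∈p-y⇒x≢y p (subst (_ ∈_) (sym p-x≡yz) w∈)

∈-image⁺ : ∀ (f : Fin k → Fin n) {X u} → u ∈ X → f u ∈ image f X
∈-image⁺ f {true ∷ X} here = x∈⁅x⁆∪p (f Fin.zero) _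
∈-image⁺ f {true ∷ X} (there u∈X) = ∈⁅x⁆∪p (f Fin.zero) (∈-image⁺ (f ∘ Fin.suc) u∈X)
∈-image⁺ f {false ∷ X} (there u∈X) = ∈-image⁺ (f ∘ Fin.suc) u∈X

∈-image⁻ : ∀ (f : Fin k → Fin n) {X w} → w ∈ image f X → ∃ λ u → u ∈ X × f u ≡ w
∈-image⁻ f {[]} w∈ = ⊥-elim (∉⊥ w∈)
∈-image⁻ f {true ∷ X} w∈ with ∈-⁅⁆∪⁻ _ w∈
... | inj₁ w≡f0 = Fin.zero , here , sym w≡f0
... | inj₂ w∈fX with ∈-image⁻ (f ∘ Fin.suc) w∈fX
... | u , u∈X , fu≡w = Fin.suc u , there u∈X , fu≡w
∈-image⁻ f {false ∷ X} w∈ with ∈-image⁻ (f ∘ Fin.suc) w∈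
... | u , u∈X , fu≡w = Fin.suc u , there u∈X , fu≡w

image-⊆ : ∀ (f : Fin k → Fin n) {X Y} → Y ⊆ X → image f Y ⊆ image f X
image-⊆ f Y⊆X w∈ with ∈-image⁻ f w∈
... | u , u∈Y , refl = ∈-image⁺ f (Y⊆X u∈Y)

image-⁅⁆ : ∀ (f : Fin k → Fin n) u → image f ⁅ u ⁆ ≡ ⁅ f u ⁆
image-⁅⁆ f u = ⊆-antisym fu-only (⁅x⁆⊆p (∈-image⁺ f (x∈⁅x⁆ u)))
  where
  fu-only : image f ⁅ u ⁆ ⊆ ⁅ f u ⁆
  fu-only w∈ with ∈-image⁻ f w∈
  ... | u′ , u′∈ , refl = subst (λ u″ → f u′ ∈ ⁅ f u″ ⁆) (x∈⁅y⁆⇒x≡y u u′∈) (x∈⁅x⁆ (f u′))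

∣image∣ : ∀ {f : Fin k → Fin n} → Injective _≡_ _≡_ f → ∀ X → ∣ image f X ∣ ≡ ∣ X ∣
∣image∣ {n = n} f-inj [] = ∣⊥∣≡0 n
∣image∣ f-inj (false ∷ X) = ∣image∣ (Fin.suc-injective ∘ f-inj) X
∣image∣ {f = f} f-inj (true ∷ X) =
  trans (∣⁅x⁆∪p∣≡1+∣p∣ (f Fin.zero) _ f0∉) (cong suc (∣image∣ (Fin.suc-injective ∘ f-inj) X))
  where
  f0∉ : f Fin.zero ∉ image (f ∘ Fin.suc) X
  f0∉ f0∈ with ∈-image⁻ (f ∘ Fin.suc) f0∈
  ... | _ , _ , f1+u≡f0 with () ← f-inj f1+u≡f0

missing-vertex : m < n → (f : Fin m → Fin n) → ∃ λ v → ∀ u → f u ≢ v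
missing-vertex {m} {n} m<n f with Fin.all? (λ v → Fin.any? λ u → f u Fin.≟ v)
... | yes onto = contradiction (Fin.injective⇒≤ section-injective) (ℕ.<⇒≱ m<n)
  where
  section-injective : Injective _≡_ _≡_ (λ v → proj₁ (onto v))
  section-injective {v} {w} eq = trans (sym (proj₂ (onto v))) (trans (cong f eq) (proj₂ (onto w)))
... | no ¬onto =
  let v , ¬hit = Fin.¬∀⟶∃¬ n _ (λ v → Fin.any? λ u → f u Fin.≟ v) ¬onto in v , λ u fu≡v → ¬hit (u , fu≡v)

-- Triangular sets of a boolean matrix

∷ᶠ-injective : ∀ {A : Set} {a : A} {g : Fin n → A} → Injective _≡_ _≡_ g → (∀ j → g j ≢ a) →
               Injective _≡_ _≡_ (a ∷ᶠ g)
∷ᶠ-injective g-inj g≢a {Fin.zero} {Fin.zero} _ = refl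
∷ᶠ-injective g-inj g≢a {Fin.zero} {Fin.suc j} a≡gj = contradiction (sym a≡gj) (g≢a j)
∷ᶠ-injective g-inj g≢a {Fin.suc j} {Fin.zero} gj≡a = contradiction gj≡a (g≢a j)
∷ᶠ-injective g-inj g≢a {Fin.suc j} {Fin.suc l} gj≡gl = cong Fin.suc (g-inj gj≡gl)

module Triangularity {r n : ℕ} (M : Fin r → Fin n → Bool) where

  Triangularₖ : ℕ → Subset n → Set
  Triangularₖ k X =
    Σ (Fin k → Fin r) λ ρ → Σ (Fin k → Fin n) λ σ →
      Injective _≡_ _≡_ ρ × Injective _≡_ _≡_ σ ×
      (∀ v → (v ∈ X) ⇔ (∃ λ j → σ j ≡ v)) ×
      (∀ j → M (ρ j) (σ j) ≡ true) ×
      (∀ j l → j <ᶠ l → M (ρ j) (σ l) ≡ false)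

  ZeroOn : Fin r → Subset n → Set
  ZeroOn ρ X = ∀ w → w ∈ X → M ρ w ≡ false

  Isolated : Subset n → Fin n → Set
  Isolated X x = ∃ λ ρ → M ρ x ≡ true × ZeroOn ρ (X - x)

  Unfolding : Subset n → Set
  Unfolding X = ∃ λ x → x ∈ X × Isolated X x × Triangular M (X - x)

  triangular-empty : ∀ {X} → Empty X → Triangular M X
  triangular-empty X-empty =
    0 , (λ ()) , (λ ()) , (λ {}) , (λ {}) ,
    (λ v → mk⇔ (λ v∈X → contradiction (v , v∈X) X-empty) λ ()) , (λ ()) , λ ()

  triangular-⁅⁆∪ : ∀ {X x ρ} → Triangular M X → M ρ x ≡ true → ZeroOn ρ X → Triangular M (⁅ x ⁆ ∪ X)
  triangular-⁅⁆∪ {X} {x} {ρ₀} (k , ρ , σ , ρ-inj , σ-inj , σ-onto , diag , above) ρ₀x zeros =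
    suc k , ρ₀ ∷ᶠ ρ , x ∷ᶠ σ , ∷ᶠ-injective ρ-inj ρ≢ρ₀ , ∷ᶠ-injective σ-inj σ≢x , onto , diag′ , above′
    where
    σ∈X : ∀ j → σ j ∈ X
    σ∈X j = Equivalence.from (σ-onto (σ j)) (j , refl)
    ρ≢ρ₀ : ∀ j → ρ j ≢ ρ₀
    ρ≢ρ₀ j refl with () ← trans (sym (diag j)) (zeros (σ j) (σ∈X j))
    σ≢x : ∀ j → σ j ≢ x
    σ≢x j refl with () ← trans (sym ρ₀x) (zeros (σ j) (σ∈X j))
    onto : ∀ v → (v ∈ ⁅ x ⁆ ∪ X) ⇔ (∃ λ j → (x ∷ᶠ σ) j ≡ v)
    onto v = mk⇔ to from
      where
      to : v ∈ ⁅ x ⁆ ∪ X → ∃ λ j → (x ∷ᶠ σ) j ≡ v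
      to v∈ with ∈-⁅⁆∪⁻ X v∈
      ... | inj₁ refl = Fin.zero , refl
      ... | inj₂ v∈X with Equivalence.to (σ-onto v) v∈X
      ... | j , σj≡v = Fin.suc j , σj≡v
      from : (∃ λ j → (x ∷ᶠ σ) j ≡ v) → v ∈ ⁅ x ⁆ ∪ X
      from (Fin.zero , refl) = x∈⁅x⁆∪p x X
      from (Fin.suc j , refl) = ∈⁅x⁆∪p x (σ∈X j)
    diag′ : ∀ j → M ((ρ₀ ∷ᶠ ρ) j) ((x ∷ᶠ σ) j) ≡ true
    diag′ Fin.zero = ρ₀x
    diag′ (Fin.suc j) = diag j
    above′ : ∀ j l → j <ᶠ l → M ((ρ₀ ∷ᶠ ρ) j) ((x ∷ᶠ σ) l) ≡ false
    above′ Fin.zero (Fin.suc l) _ = zeros (σ l) (σ∈X l)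
    above′ (Fin.suc j) (Fin.suc l) (s≤s j<l) = above j l j<l

  fold : ∀ {X} → Unfolding X → Triangular M X
  fold {X} (x , x∈X , (ρ , ρx , zeros) , rest) =
    subst (Triangular M) (sym (p≡⁅x⁆∪p-x x∈X)) (triangular-⁅⁆∪ rest ρx zeros)

  triangular₀⇒Empty : ∀ {X} → Triangularₖ 0 X → Empty X
  triangular₀⇒Empty (_ , σ , _ , _ , σ-onto , _) (v , v∈X) with () ← Equivalence.to (σ-onto v) v∈X

  peel : ∀ {k X} → Triangularₖ (suc k) X → ∃ λ x → x ∈ X × Isolated X x × Triangularₖ k (X - x)
  peel {k} {X} (ρ , σ , ρ-inj , σ-inj , σ-onto , diag , above) =
    σ Fin.zero , σ∈X Fin.zero , (ρ Fin.zero , diag Fin.zero , zeros) ,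
    ρ ∘ Fin.suc , σ ∘ Fin.suc , Fin.suc-injective ∘ ρ-inj , Fin.suc-injective ∘ σ-inj , onto ,
    diag ∘ Fin.suc , λ j l j<l → above (Fin.suc j) (Fin.suc l) (s≤s j<l)
    where
    σ∈X : ∀ j → σ j ∈ X
    σ∈X j = Equivalence.from (σ-onto (σ j)) (j , refl)
    later : ∀ {w} → w ∈ X - σ Fin.zero → ∃ λ j → σ (Fin.suc j) ≡ w
    later {w} w∈ with Equivalence.to (σ-onto w) (p─q⊆p X _ w∈)
    ... | Fin.zero , σ0≡w = contradiction (sym σ0≡w) (x∈p-y⇒x≢y X w∈)
    ... | Fin.suc j , σj≡w = j , σj≡w
    zeros : ZeroOn (ρ Fin.zero) (X - σ Fin.zero)
    zeros w w∈ with later w∈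
    ... | j , refl = above Fin.zero (Fin.suc j) (s≤s z≤n)
    onto : ∀ v → (v ∈ X - σ Fin.zero) ⇔ (∃ λ j → σ (Fin.suc j) ≡ v)
    onto v = mk⇔ later λ { (j , refl) →
      x∈p∧x≢y⇒x∈p-y (σ∈X (Fin.suc j)) (λ σj≡σ0 → Fin.0≢1+n (sym (σ-inj σj≡σ0))) }

  unfold : ∀ {X} → Triangular M X → Empty X ⊎ Unfolding X
  unfold (zero , t) = inj₁ (triangular₀⇒Empty t)
  unfold (suc k , t) with peel t
  ... | x , x∈X , isolated , rest = inj₂ (x , x∈X , isolated , k , rest)

  isolated-pivot : ∀ {X} → Triangular M X → Nonempty X → ∃ λ x → x ∈ X × Isolated X x
  isolated-pivot t X-nonempty with unfold t
  ... | inj₁ X-empty = contradiction X-nonempty X-empty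
  ... | inj₂ (x , x∈X , isolated , _) = x , x∈X , isolated

  triangular-⊆ : ∀ {X Y} → Y ⊆ X → Triangular M X → Triangular M Y
  triangular-⊆ {X} {Y} Y⊆X (k , t) = go k t Y⊆X
    where
    go : ∀ k {X Y} → Triangularₖ k X → Y ⊆ X → Triangular M Y
    go zero t Y⊆X = triangular-empty λ (y , y∈Y) → triangular₀⇒Empty t (y , Y⊆X y∈Y)
    go (suc k) {X} {Y} t Y⊆X with peel t
    ... | x , x∈X , (ρ , ρx , zeros) , rest with x ∈? Y
    ... | no x∉Y = go k rest λ y∈Y → x∈p∧x≢y⇒x∈p-y (Y⊆X y∈Y) λ { refl → x∉Y y∈Y }
    ... | yes x∈Y = fold (x , x∈Y , (ρ , ρx , λ w w∈ → zeros w (Y-x⊆X-x w∈)) , go k rest Y-x⊆X-x)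
      where
      Y-x⊆X-x : Y - x ⊆ X - x
      Y-x⊆X-x y∈ = x∈p∧x≢y⇒x∈p-y (Y⊆X (p─q⊆p Y _ y∈)) (x∈p-y⇒x≢y Y y∈)

  isolated? : ∀ X x → Dec (Isolated X x)
  isolated? X x =
    Fin.any? λ ρ → (M ρ x Bool.≟ true) ×-dec Fin.all? λ w → (w ∈? X - x) →-dec (M ρ w Bool.≟ false)

  triangular? : ∀ X → Dec (Triangular M X)
  triangular? X = go ∣ X ∣ X ℕ.≤-refl
    where
    go : ∀ c X → ∣ X ∣ ≤ c → Dec (Triangular M X)
    go zero X ∣X∣≤0 = yes (triangular-empty (∣p∣≡0⇒Empty X (ℕ.n≤0⇒n≡0 ∣X∣≤0)))
    go (suc c) X ∣X∣≤1+c = map′ [ triangular-empty , fold ] unfold (¬? (nonempty? X) ⊎-dec Fin.any? pivot?)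
      where
      pivot? : ∀ x → Dec (x ∈ X × Isolated X x × Triangular M (X - x))
      pivot? x with x ∈? X
      ... | no x∉X = no (x∉X ∘ proj₁)
      ... | yes x∈X =
        map′ (x∈X ,_) proj₂
          (isolated? X x ×-dec go c (X - x) (ℕ.≤-pred (ℕ.≤-trans (x∈p⇒∣p-x∣<∣p∣ x∈X) ∣X∣≤1+c)))

module _ {r k n : ℕ} (M : Fin r → Fin n → Bool) {f : Fin k → Fin n} (f-inj : Injective _≡_ _≡_ f) where

  triangular-image⁺ : ∀ {X} → Triangular (λ ρ → M ρ ∘ f) X → Triangular M (image f X)
  triangular-image⁺ {X} (j , ρ , σ , ρ-inj , σ-inj , σ-onto , diag , above) =
    j , ρ , f ∘ σ , ρ-inj , σ-inj ∘ f-inj , onto , diag , above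
    where
    onto : ∀ w → (w ∈ image f X) ⇔ (∃ λ i → f (σ i) ≡ w)
    onto w = mk⇔ to from
      where
      to : w ∈ image f X → ∃ λ i → f (σ i) ≡ w
      to w∈ with ∈-image⁻ f w∈
      ... | u , u∈X , refl with Equivalence.to (σ-onto u) u∈X
      ... | i , refl = i , refl
      from : (∃ λ i → f (σ i) ≡ w) → w ∈ image f X
      from (i , refl) = ∈-image⁺ f (Equivalence.from (σ-onto (σ i)) (i , refl))

  triangular-image⁻ : ∀ {X} → Triangular M (image f X) → Triangular (λ ρ → M ρ ∘ f) X
  triangular-image⁻ {X} (j , ρ , σ , ρ-inj , σ-inj , σ-onto , diag , above) =
    j , ρ , σ′ , ρ-inj , σ′-inj , onto , diag′ , above′
    where
    preimage : ∀ i → ∃ λ u → u ∈ X × f u ≡ σ i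
    preimage i = ∈-image⁻ f (Equivalence.from (σ-onto (σ i)) (i , refl))
    σ′ : Fin j → Fin k
    σ′ i = proj₁ (preimage i)
    fσ′ : ∀ i → f (σ′ i) ≡ σ i
    fσ′ i = proj₂ (proj₂ (preimage i))
    σ′-inj : Injective _≡_ _≡_ σ′
    σ′-inj {i} {l} σ′i≡σ′l = σ-inj (trans (sym (fσ′ i)) (trans (cong f σ′i≡σ′l) (fσ′ l)))
    onto : ∀ u → (u ∈ X) ⇔ (∃ λ i → σ′ i ≡ u)
    onto u = mk⇔ to λ { (i , refl) → proj₁ (proj₂ (preimage i)) }
      where
      to : u ∈ X → ∃ λ i → σ′ i ≡ u
      to u∈X with Equivalence.to (σ-onto (f u)) (∈-image⁺ f u∈X)
      ... | i , σi≡fu = i , f-inj (trans (fσ′ i) σi≡fu)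
    diag′ : ∀ i → M (ρ i) (f (σ′ i)) ≡ true
    diag′ i = trans (cong (M (ρ i)) (fσ′ i)) (diag i)
    above′ : ∀ i l → i <ᶠ l → M (ρ i) (f (σ′ l)) ≡ false
    above′ i l i<l = trans (cong (M (ρ i)) (fσ′ l)) (above i l i<l)

-- Representable complexes

module _ {A : Set} where

  ⌊⌋≡true⇒ : (a? : Dec A) → ⌊ a? ⌋ ≡ true → A
  ⌊⌋≡true⇒ (yes a) _ = a

  ⌊⌋≡false⇒ : (a? : Dec A) → ⌊ a? ⌋ ≡ false → ¬ A
  ⌊⌋≡false⇒ (no ¬a) _ = ¬a

  ⇒⌊⌋≡true : (a? : Dec A) → A → ⌊ a? ⌋ ≡ true
  ⇒⌊⌋≡true (yes _) _ = refl
  ⇒⌊⌋≡true (no ¬a) a = contradiction a ¬a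

  ⇒⌊⌋≡false : (a? : Dec A) → ¬ A → ⌊ a? ⌋ ≡ false
  ⇒⌊⌋≡false (yes a) ¬a = contradiction a ¬a
  ⇒⌊⌋≡false (no _) _ = refl

∧-true : ∀ {x y} → x ∧ y ≡ true → x ≡ true × y ≡ true
∧-true {true} {true} _ = refl , refl

not-true : ∀ {x} → not x ≡ true → x ≡ false
not-true {false} _ = refl

module _ {r n : ℕ} (M : Fin r → Fin n → Bool) where

  open Triangularity M

  Represented : Faces n
  Represented X = ⌊ triangular? X ⌋

  represented-isBRSC : (∀ x → Triangular M ⁅ x ⁆) → IsBRSC Represented
  represented-isBRSC singletons-triangular =
    record
      { singletons = λ x → ⇒⌊⌋≡true (triangular? ⁅ x ⁆) (singletons-triangular x)
      ; downClosed = λ X Y Y⊆X MX →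
          ⇒⌊⌋≡true (triangular? Y) (triangular-⊆ Y⊆X (⌊⌋≡true⇒ (triangular? X) MX))
      } ,
    r , M , λ X → mk⇔ (⌊⌋≡true⇒ (triangular? X)) (⇒⌊⌋≡true (triangular? X))

  truncation-isTBRSC : ∀ {k} {F : Faces n} → 1 ≤ k → (∀ x → Triangular M ⁅ x ⁆) →
                       (∀ X → (F X ≡ true) ⇔ (Triangular M X × ∣ X ∣ ≤ k)) → IsTBRSC F
  truncation-isTBRSC {k} {F} 1≤k singletons-triangular F⇔ =
    k , 1≤k , Represented , represented-isBRSC singletons-triangular , λ X → bool-ext (F⇒T X) (T⇒F X)
    where
    bool-ext : ∀ {b c} → (b ≡ true → c ≡ true) → (c ≡ true → b ≡ true) → b ≡ c
    bool-ext {false} {false} _ _ = refl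
    bool-ext {false} {true} _ c⇒b = c⇒b refl
    bool-ext {true} b⇒c _ = sym (b⇒c refl)
    F⇒T : ∀ X → F X ≡ true → Trunc k Represented X ≡ true
    F⇒T X FX = let t , ∣X∣≤k = Equivalence.to (F⇔ X) FX in
      cong₂ _∧_ (⇒⌊⌋≡true (triangular? X) t) (⇒⌊⌋≡true (∣ X ∣ ℕ.≤? k) ∣X∣≤k)
    T⇒F : ∀ X → Trunc k Represented X ≡ true → F X ≡ true
    T⇒F X TX = let t , ∣X∣≤k = ∧-true TX in
      Equivalence.from (F⇔ X) (⌊⌋≡true⇒ (triangular? X) t , ⌊⌋≡true⇒ (∣ X ∣ ℕ.≤? k) ∣X∣≤k)

paving : ∀ {n} {F : Faces n} → DimLe2 F → (∀ X → ∣ X ∣ ≤ 2 → F X ≡ true) → Paving F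
paving dim≤2 small-faces I FI _ X 1+∣X∣≡∣I∣ =
  small-faces X (ℕ.≤-pred (ℕ.≤-trans (ℕ.≤-reflexive 1+∣X∣≡∣I∣) (dim≤2 I FI)))

restrictAlong-isSC : ∀ (f : Fin k → Fin n) {F} → IsSC F → IsSC (restrictAlong f F)
restrictAlong-isSC f {F} F-isSC = record
  { singletons = λ u → subst (λ X → F X ≡ true) (sym (image-⁅⁆ f u)) (IsSC.singletons F-isSC (f u))
  ; downClosed = λ X Y Y⊆X → IsSC.downClosed F-isSC (image f X) (image f Y) (image-⊆ f Y⊆X)
  }

-- The counterexample

module Counterexample (L : ℕ) where

  N : ℕ
  N = 8 + L

  data NonfaceTriple : ℕ → ℕ → ℕ → Set where
    consecutive : ∀ i → NonfaceTriple i (1 + i) (2 + i)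
    closing : ∀ {a} → a ≤ 1 → NonfaceTriple a (6 + L) (7 + L)

  nonfaceTriple? : ∀ i j k → Dec (NonfaceTriple i j k)
  nonfaceTriple? i j k =
    map′ from to ((j ℕ.≟ 1 + i ×-dec k ℕ.≟ 2 + i) ⊎-dec (i ℕ.≤? 1 ×-dec j ℕ.≟ 6 + L ×-dec k ℕ.≟ 7 + L))
    where
    from : (j ≡ 1 + i × k ≡ 2 + i) ⊎ (i ≤ 1 × j ≡ 6 + L × k ≡ 7 + L) → NonfaceTriple i j k
    from (inj₁ (refl , refl)) = consecutive i
    from (inj₂ (i≤1 , refl , refl)) = closing i≤1
    to : NonfaceTriple i j k → (j ≡ 1 + i × k ≡ 2 + i) ⊎ (i ≤ 1 × j ≡ 6 + L × k ≡ 7 + L)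
    to (consecutive i) = inj₁ (refl , refl)
    to (closing i≤1) = inj₂ (i≤1 , refl , refl)

  nonfaceTriple-ordered : ∀ {i j k} → NonfaceTriple i j k → i < j × k ≡ suc j
  nonfaceTriple-ordered (consecutive i) = ℕ.n<1+n i , refl
  nonfaceTriple-ordered (closing a≤1) = ℕ.≤-trans (s≤s a≤1) (s≤s (s≤s z≤n)) , refl

  IsNonface : Fin N → Fin N → Fin N → Set
  IsNonface a b c = NonfaceTriple (toℕ a) (toℕ b) (toℕ c)

  isNonface : ∀ {a b c i j k} → toℕ a ≡ i → toℕ b ≡ j → toℕ c ≡ k → NonfaceTriple i j k → IsNonface a b c
  isNonface refl refl refl nf = nf

  isNonface-distinct : ∀ {a b c} → IsNonface a b c → a ≢ b × a ≢ c × b ≢ c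
  isNonface-distinct nf with nonfaceTriple-ordered nf
  ... | a<b , c≡1+b =
    (λ { refl → ℕ.<-irrefl refl a<b }) ,
    (λ { refl → ℕ.<-irrefl refl (ℕ.<-trans a<b (ℕ.≤-reflexive (sym c≡1+b))) }) ,
    (λ { refl → ℕ.1+n≢n (sym c≡1+b) })

  ContainsNonface : Subset N → Set
  ContainsNonface X = ∃ λ a → ∃ λ b → ∃ λ c → IsNonface a b c × a ∈ X × b ∈ X × c ∈ X

  -- Opaque, since unfolding the exhaustive search makes conversion checking explode.
  opaque
    containsNonface? : ∀ X → Dec (ContainsNonface X)
    containsNonface? X =
      Fin.any? λ a → Fin.any? λ b → Fin.any? λ c →
        nonfaceTriple? (toℕ a) (toℕ b) (toℕ c) ×-dec a ∈? X ×-dec b ∈? X ×-dec c ∈? X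

  containsNonface-⊆ : ∀ {X Y} → X ⊆ Y → ContainsNonface X → ContainsNonface Y
  containsNonface-⊆ X⊆Y (a , b , c , nf , a∈ , b∈ , c∈) = a , b , c , nf , X⊆Y a∈ , X⊆Y b∈ , X⊆Y c∈

  containsNonface⇒3≤∣X∣ : ∀ {X} → ContainsNonface X → 3 ≤ ∣ X ∣
  containsNonface⇒3≤∣X∣ (a , b , c , nf , a∈ , b∈ , c∈) with isNonface-distinct nf
  ... | a≢b , a≢c , b≢c = distinct⇒3≤∣p∣ a≢b a≢c b≢c a∈ b∈ c∈

  ¬containsNonface-minus : ∀ {X w} → ∣ X ∣ ≤ 3 → w ∈ X → ¬ ContainsNonface (X - w)
  ¬containsNonface-minus ∣X∣≤3 w∈X nonface =
    ℕ.<-irrefl refl (ℕ.≤-<-trans (containsNonface⇒3≤∣X∣ nonface) (ℕ.<-≤-trans (x∈p⇒∣p-x∣<∣p∣ w∈X) ∣X∣≤3))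

  nonface-covers : ∀ {X a b c w} → ∣ X ∣ ≤ 3 → IsNonface a b c → a ∈ X → b ∈ X → c ∈ X → w ∈ X →
                   w ≡ a ⊎ w ≡ b ⊎ w ≡ c
  nonface-covers {X} {a} {b} {c} {w} ∣X∣≤3 nf a∈ b∈ c∈ w∈ with w Fin.≟ a | w Fin.≟ b | w Fin.≟ c
  ... | yes w≡a | _ | _ = inj₁ w≡a
  ... | no _ | yes w≡b | _ = inj₂ (inj₁ w≡b)
  ... | no _ | no _ | yes w≡c = inj₂ (inj₂ w≡c)
  ... | no w≢a | no w≢b | no w≢c = contradiction (a , b , c , nf , minus a∈ w≢a , minus b∈ w≢b , minus c∈ w≢c)
                                     (¬containsNonface-minus ∣X∣≤3 w∈)
    where
    minus : ∀ {u} → u ∈ X → w ≢ u → u ∈ X - w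
    minus u∈ w≢u = x∈p∧x≢y⇒x∈p-y u∈ (w≢u ∘ sym)

  Δ : Faces N
  Δ X = ⌊ ∣ X ∣ ℕ.≤? 3 ⌋ ∧ not ⌊ containsNonface? X ⌋

  Δ-face⁺ : ∀ {X} → ∣ X ∣ ≤ 3 → ¬ ContainsNonface X → Δ X ≡ true
  Δ-face⁺ {X} ∣X∣≤3 ¬nonface =
    cong₂ (λ s t → s ∧ not t) (⇒⌊⌋≡true (∣ X ∣ ℕ.≤? 3) ∣X∣≤3) (⇒⌊⌋≡false (containsNonface? X) ¬nonface)

  Δ-face⁻ : ∀ {X} → Δ X ≡ true → ∣ X ∣ ≤ 3 × ¬ ContainsNonface X
  Δ-face⁻ {X} ΔX with ∧-true ΔX
  ... | ∣X∣≤3 , ¬nonface = ⌊⌋≡true⇒ (∣ X ∣ ℕ.≤? 3) ∣X∣≤3 , ⌊⌋≡false⇒ (containsNonface? X) (not-true ¬nonface)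

  Δ-small : ∀ {X} → ∣ X ∣ ≤ 2 → Δ X ≡ true
  Δ-small ∣X∣≤2 =
    Δ-face⁺ (ℕ.m≤n⇒m≤1+n ∣X∣≤2) λ nonface → ℕ.<-irrefl refl (ℕ.≤-trans (containsNonface⇒3≤∣X∣ nonface) ∣X∣≤2)

  Δ-isSC : IsSC Δ
  Δ-isSC = record
    { singletons = λ v → Δ-small (ℕ.≤-trans (ℕ.≤-reflexive (∣⁅x⁆∣≡1 v)) (s≤s z≤n))
    ; downClosed = λ X Y Y⊆X ΔX → let ∣X∣≤3 , ¬nonface = Δ-face⁻ ΔX in
        Δ-face⁺ (ℕ.≤-trans (p⊆q⇒∣p∣≤∣q∣ Y⊆X) ∣X∣≤3) (¬nonface ∘ containsNonface-⊆ Y⊆X)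
    }

  vertex : ∀ i → i < N → Fin N
  vertex i i<N = Fin.fromℕ< i<N

  toℕ-vertex : ∀ {i} (i<N : i < N) → toℕ (vertex i i<N) ≡ i
  toℕ-vertex i<N = Fin.toℕ-fromℕ< i<N

  v₀ v₁ : Fin N
  v₀ = Fin.zero
  v₁ = Fin.suc Fin.zero

  v₆ v₇ : Fin N
  v₆ = vertex (6 + L) (ℕ.n≤1+n (7 + L))
  v₇ = vertex (7 + L) ℕ.≤-refl

  toℕ-v₆ : toℕ v₆ ≡ 6 + L
  toℕ-v₆ = toℕ-vertex (ℕ.n≤1+n (7 + L))

  toℕ-v₇ : toℕ v₇ ≡ 7 + L
  toℕ-v₇ = toℕ-vertex ℕ.≤-refl

  T₀ : Subset N
  T₀ = triple v₀ v₁ v₇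

  ∈T₀⁻ : ∀ {w} → w ∈ T₀ → w ≡ v₀ ⊎ w ≡ v₁ ⊎ w ≡ v₇
  ∈T₀⁻ = ∈-triple⁻

  v₇≢v₀ : v₇ ≢ v₀
  v₇≢v₀ v₇≡v₀ with () ← trans (sym toℕ-v₇) (cong toℕ v₇≡v₀)

  v₇≢v₁ : v₇ ≢ v₁
  v₇≢v₁ v₇≡v₁ with () ← trans (sym toℕ-v₇) (cong toℕ v₇≡v₁)

  T₀-values : ∀ {w} → w ∈ T₀ → toℕ w ≡ 0 ⊎ toℕ w ≡ 1 ⊎ toℕ w ≡ 7 + L
  T₀-values w∈ with ∈T₀⁻ w∈
  ... | inj₁ refl = inj₁ refl
  ... | inj₂ (inj₁ refl) = inj₂ (inj₁ refl)
  ... | inj₂ (inj₂ refl) = inj₂ (inj₂ toℕ-v₇)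

  T₀-nonface-free : ¬ ContainsNonface T₀
  T₀-nonface-free (a , b , c , nf , _ , b∈ , c∈) = value≢6+L (T₀-values b∈) (middle≡6+L nf (T₀-values c∈))
    where
    value≢6+L : ∀ {t} → t ≡ 0 ⊎ t ≡ 1 ⊎ t ≡ 7 + L → t ≢ 6 + L
    value≢6+L (inj₁ refl) ()
    value≢6+L (inj₂ (inj₁ refl)) ()
    value≢6+L (inj₂ (inj₂ refl)) = ℕ.1+n≢n
    middle≡6+L : ∀ {i j k} → NonfaceTriple i j k → k ≡ 0 ⊎ k ≡ 1 ⊎ k ≡ 7 + L → j ≡ 6 + L
    middle≡6+L (consecutive i) (inj₂ (inj₂ 2+i≡7+L)) = ℕ.suc-injective 2+i≡7+L
    middle≡6+L (closing _) _ = refl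

  T₀-face : Δ T₀ ≡ true
  T₀-face = Δ-face⁺ (∣triple∣≤3 v₀ v₁ v₇) T₀-nonface-free

  module NotRepresentable {k r : ℕ} {F : Faces N} (M : Fin r → Fin N → Bool)
    (represents : ∀ X → (F X ≡ true) ⇔ Triangular M X) (Δ≡TkF : ∀ X → Δ X ≡ Trunc k F X) where

    open Triangularity M

    face⇒triangular : ∀ {X} → Δ X ≡ true → Triangular M X
    face⇒triangular {X} ΔX = Equivalence.to (represents X) (proj₁ (∧-true (trans (sym (Δ≡TkF X)) ΔX)))

    triangular⇒face : ∀ {X} → Triangular M X → ∣ X ∣ ≤ k → Δ X ≡ true
    triangular⇒face {X} t ∣X∣≤k =
      trans (Δ≡TkF X) (cong₂ _∧_ (Equivalence.from (represents X) t) (⇒⌊⌋≡true (∣ X ∣ ℕ.≤? k) ∣X∣≤k))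

    3≤k : 3 ≤ k
    3≤k = subst (_≤ k) (∣triple∣≡3 (λ ()) (v₇≢v₀ ∘ sym) (v₇≢v₁ ∘ sym))
      (⌊⌋≡true⇒ (∣ T₀ ∣ ℕ.≤? k) (proj₂ (∧-true (trans (sym (Δ≡TkF T₀)) T₀-face))))

    -- A 1 at p would extend the triangular pair {x, y} to a triangular, hence face, triple {p, x, y}.
    zero-closure : ∀ ρ {p x y} → ContainsNonface (triple p x y) → M ρ x ≡ false → M ρ y ≡ false → M ρ p ≡ false
    zero-closure ρ {p} {x} {y} nonface ρx ρy = ¬-not λ ρp →
      proj₂ (Δ-face⁻ (triangular⇒face (triangular-⁅⁆∪ pair-triangular ρp zeros) ∣pxy∣≤k)) nonface
      where
      pair-triangular : Triangular M (pair x y)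
      pair-triangular = face⇒triangular (Δ-small (∣pair∣≤2 x y))
      ∣pxy∣≤k : ∣ triple p x y ∣ ≤ k
      ∣pxy∣≤k = ℕ.≤-trans (∣triple∣≤3 p x y) 3≤k
      zeros : ZeroOn ρ (pair x y)
      zeros w w∈ with ∈-pair⁻ w∈
      ... | inj₁ refl = ρx
      ... | inj₂ refl = ρy

    module _ (ρ : Fin r) where

      Zero : ℕ → Set
      Zero i = ∀ w → toℕ w ≡ i → M ρ w ≡ false

      zero-upward : Zero 0 → Zero 1 → ∀ i → Zero i
      zero-upward Z₀ Z₁ i = proj₁ (adjacent i)
        where
        step : ∀ {i} → Zero i → Zero (1 + i) → Zero (2 + i)
        step {i} Zi Z1+i w w≡2+i =
          zero-closure ρ (a , b , w , isNonface (toℕ-vertex i<N) (toℕ-vertex 1+i<N) w≡2+i (consecutive i) ,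
                          y∈triple w a b , z∈triple w a b , x∈triple w a b)
            (Zi a (toℕ-vertex i<N)) (Z1+i b (toℕ-vertex 1+i<N))
          where
          1+i<N : 1 + i < N
          1+i<N = ℕ.<-trans (ℕ.n<1+n (1 + i)) (subst (_< N) w≡2+i (Fin.toℕ<n w))
          i<N : i < N
          i<N = ℕ.<-trans (ℕ.n<1+n i) 1+i<N
          a b : Fin N
          a = vertex i i<N
          b = vertex (1 + i) 1+i<N
        adjacent : ∀ i → Zero i × Zero (suc i)
        adjacent zero = Z₀ , Z₁
        adjacent (suc i) = let Zi , Z1+i = adjacent i in Z1+i , step Zi Z1+i

      low⇒v₆ : ∀ u → toℕ u ≤ 1 → M ρ u ≡ false → M ρ v₇ ≡ false → M ρ v₆ ≡ false
      low⇒v₆ u u≤1 ρu ρv₇ = zero-closure ρ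
        (u , v₆ , v₇ , isNonface refl toℕ-v₆ toℕ-v₇ (closing u≤1) ,
         y∈triple v₆ u v₇ , x∈triple v₆ u v₇ , z∈triple v₆ u v₇) ρu ρv₇

      v₆⇒low : ∀ u → toℕ u ≤ 1 → M ρ v₆ ≡ false → M ρ v₇ ≡ false → M ρ u ≡ false
      v₆⇒low u u≤1 ρv₆ ρv₇ = zero-closure ρ
        (u , v₆ , v₇ , isNonface refl toℕ-v₆ toℕ-v₇ (closing u≤1) ,
         x∈triple u v₆ v₇ , y∈triple u v₆ v₇ , z∈triple u v₆ v₇) ρv₆ ρv₇

    -- The zeros of the leading row spread to its pivot: upwards from 0 and 1 if the pivot is 7 + L,
    -- and through the two nonfaces {a, 6 + L, 7 + L} otherwise.
    T₀-not-triangular : ¬ Triangular M T₀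
    T₀-not-triangular t with isolated-pivot t (v₀ , x∈triple v₀ v₁ v₇)
    ... | x , x∈T₀ , ρ , ρx , zeros = contradiction (trans (sym ρx) (pivot-zero (∈T₀⁻ x∈T₀))) λ ()
      where
      zero-at : ∀ {w} → w ∈ T₀ → w ≢ x → M ρ w ≡ false
      zero-at w∈ w≢x = zeros _ (x∈p∧x≢y⇒x∈p-y w∈ w≢x)
      pivot-zero : x ≡ v₀ ⊎ x ≡ v₁ ⊎ x ≡ v₇ → M ρ x ≡ false
      pivot-zero (inj₁ refl) =
        v₆⇒low ρ v₀ z≤n (low⇒v₆ ρ v₁ ℕ.≤-refl ρv₁ ρv₇) ρv₇
        where
        ρv₁ : M ρ v₁ ≡ false
        ρv₁ = zero-at (y∈triple v₀ v₁ v₇) λ ()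
        ρv₇ : M ρ v₇ ≡ false
        ρv₇ = zero-at (z∈triple v₀ v₁ v₇) v₇≢v₀
      pivot-zero (inj₂ (inj₁ refl)) =
        v₆⇒low ρ v₁ ℕ.≤-refl (low⇒v₆ ρ v₀ z≤n ρv₀ ρv₇) ρv₇
        where
        ρv₀ : M ρ v₀ ≡ false
        ρv₀ = zero-at (x∈triple v₀ v₁ v₇) λ ()
        ρv₇ : M ρ v₇ ≡ false
        ρv₇ = zero-at (z∈triple v₀ v₁ v₇) v₇≢v₁
      pivot-zero (inj₂ (inj₂ refl)) = zero-upward ρ Z₀ Z₁ (toℕ v₇) v₇ refl
        where
        Z₀ : Zero ρ 0
        Z₀ w w≡0 = subst (λ u → M ρ u ≡ false) (sym (Fin.toℕ-injective {j = v₀} w≡0))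
          (zero-at (x∈triple v₀ v₁ v₇) (v₇≢v₀ ∘ sym))
        Z₁ : Zero ρ 1
        Z₁ w w≡1 = subst (λ u → M ρ u ≡ false) (sym (Fin.toℕ-injective {j = v₁} w≡1))
          (zero-at (y∈triple v₀ v₁ v₇) (v₇≢v₁ ∘ sym))

  Δ-not-TBRSC : ¬ IsTBRSC Δ
  Δ-not-TBRSC (_ , _ , _ , (_ , _ , M , represents) , Δ≡TkF) = T₀-not-triangular (face⇒triangular T₀-face)
    where open NotRepresentable M represents Δ≡TkF

  Δ-not-in-TBP2 : ¬ InTBP2 Δ
  Δ-not-in-TBP2 (_ , _ , _ , Δ-TBRSC) = Δ-not-TBRSC Δ-TBRSC

  OneOf : ℕ → ℕ → ℕ → ℕ → Set
  OneOf t x y z = t ≡ x ⊎ t ≡ y ⊎ t ≡ z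

  pattern is₁ = inj₁ refl
  pattern is₂ = inj₂ (inj₁ refl)
  pattern is₃ = inj₂ (inj₂ refl)

  NonfaceAmong : ℕ → ℕ → ℕ → Set
  NonfaceAmong x y z =
    ∃ λ i → ∃ λ j → ∃ λ k → NonfaceTriple i j k × OneOf i x y z × OneOf j x y z × OneOf k x y z

  nonfaceAmong-perm : ∀ {x y z x′ y′ z′} → OneOf x x′ y′ z′ → OneOf y x′ y′ z′ → OneOf z x′ y′ z′ →
                      NonfaceAmong x y z → NonfaceAmong x′ y′ z′
  nonfaceAmong-perm x∈ y∈ z∈ (i , j , k , nf , i∈ , j∈ , k∈) = i , j , k , nf , move i∈ , move j∈ , move k∈
    where
    move : ∀ {t} → OneOf t _ _ _ → OneOf t _ _ _
    move is₁ = x∈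
    move is₂ = y∈
    move is₃ = z∈

  sorted : ∀ {x y z} → x ≢ y → x ≢ z → y ≢ z →
           ∃ λ a → ∃ λ b → ∃ λ c → a < b × b < c × OneOf a x y z × OneOf b x y z × OneOf c x y z
  sorted {x} {y} {z} x≢y x≢z y≢z with ℕ.<-cmp x y | ℕ.<-cmp y z | ℕ.<-cmp x z
  ... | tri≈ _ x≡y _ | _ | _ = contradiction x≡y x≢y
  ... | _ | tri≈ _ y≡z _ | _ = contradiction y≡z y≢z
  ... | _ | _ | tri≈ _ x≡z _ = contradiction x≡z x≢z
  ... | tri< x<y _ _ | tri< y<z _ _ | _ = x , y , z , x<y , y<z , is₁ , is₂ , is₃
  ... | tri< x<y _ _ | tri> _ _ z<y | tri< x<z _ _ = x , z , y , x<z , z<y , is₁ , is₃ , is₂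
  ... | tri< x<y _ _ | tri> _ _ z<y | tri> _ _ z<x = z , x , y , z<x , x<y , is₃ , is₁ , is₂
  ... | tri> _ _ y<x | tri< y<z _ _ | tri< x<z _ _ = y , x , z , y<x , x<z , is₂ , is₁ , is₃
  ... | tri> _ _ y<x | tri< y<z _ _ | tri> _ _ z<x = y , z , x , y<z , z<x , is₂ , is₃ , is₁
  ... | tri> _ _ y<x | tri> _ _ z<y | _ = z , y , x , z<y , y<x , is₃ , is₂ , is₁

  Close : ℕ → ℕ → Set
  Close p q = p ≤ 2 + q × q ≤ 2 + p

  pairwise-close : ∀ {x y z} → Close x y → Close x z → Close y z →
                   ∀ {s t} → OneOf s x y z → OneOf t x y z → t ≤ 2 + s
  pairwise-close xy xz yz is₁ is₁ = ℕ.m≤n+m _ 2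
  pairwise-close xy xz yz is₁ is₂ = proj₂ xy
  pairwise-close xy xz yz is₁ is₃ = proj₂ xz
  pairwise-close xy xz yz is₂ is₁ = proj₁ xy
  pairwise-close xy xz yz is₂ is₂ = ℕ.m≤n+m _ 2
  pairwise-close xy xz yz is₂ is₃ = proj₂ yz
  pairwise-close xy xz yz is₃ is₁ = proj₁ xz
  pairwise-close xy xz yz is₃ is₂ = proj₁ yz
  pairwise-close xy xz yz is₃ is₃ = ℕ.m≤n+m _ 2

  close-triple : ∀ {x y z} → x ≢ y → x ≢ z → y ≢ z → Close x y → Close x z → Close y z → NonfaceAmong x y z
  close-triple x≢y x≢z y≢z xy xz yz with sorted x≢y x≢z y≢z
  ... | a , b , c , a<b , b<c , a∈ , b∈ , c∈
    with c≤2+a ← pairwise-close xy xz yz a∈ c∈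
    with refl ← ℕ.≤-antisym (ℕ.≤-pred (ℕ.≤-trans b<c c≤2+a)) a<b
    with refl ← ℕ.≤-antisym c≤2+a b<c
    = a , suc a , suc (suc a) , consecutive a , a∈ , b∈ , c∈

  module Links (v : ℕ) (v<N : v < N) where

    High : ℕ → Set
    High t = t ≡ 6 + L ⊎ t ≡ 7 + L

    Cross : ℕ → ℕ → Set
    Cross p q = p ≤ 1 × High q × ¬ High v

    -- The possible values of two vertices lying together in a nonface that avoids v.
    Linked : ℕ → ℕ → Set
    Linked p q = Close p q ⊎ Cross p q ⊎ Cross q p

    Top : ℕ → ℕ → ℕ → Set
    Top t o₁ o₂ = v < t × o₁ < v × o₂ < v

    linked-sym : ∀ {p q} → Linked p q → Linked q p
    linked-sym (inj₁ (p≤ , q≤)) = inj₁ (q≤ , p≤)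
    linked-sym (inj₂ (inj₁ pq)) = inj₂ (inj₂ pq)
    linked-sym (inj₂ (inj₂ qp)) = inj₂ (inj₁ qp)

    6+L≤high : ∀ {t} → High t → 6 + L ≤ t
    6+L≤high (inj₁ refl) = ℕ.≤-refl
    6+L≤high (inj₂ refl) = ℕ.n≤1+n (6 + L)

    high≤7+L : ∀ {t} → High t → t ≤ 7 + L
    high≤7+L (inj₁ refl) = ℕ.n≤1+n (6 + L)
    high≤7+L (inj₂ refl) = ℕ.≤-refl

    low-not-high : ∀ {t} → t ≤ 1 → ¬ High t
    low-not-high t≤1 ht = ℕ.<⇒≱ (ℕ.≤-trans (s≤s t≤1) (s≤s (s≤s z≤n))) (6+L≤high ht)

    high-close : ∀ {p q} → High p → High q → Close p q
    high-close hp hq = within hp hq , within hq hp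
      where
      within : ∀ {s t} → High s → High t → s ≤ 2 + t
      within hs ht = ℕ.≤-trans (high≤7+L hs) (ℕ.≤-trans (ℕ.n≤1+n (7 + L)) (ℕ.+-monoʳ-≤ 2 (6+L≤high ht)))

    high-pair : ∀ {q w} → High q → High w → q ≢ w → ∀ {t} → High t → t ≡ q ⊎ t ≡ w
    high-pair (inj₁ refl) _ _ (inj₁ refl) = inj₁ refl
    high-pair (inj₂ refl) _ _ (inj₂ refl) = inj₁ refl
    high-pair (inj₁ refl) (inj₁ refl) q≢w _ = contradiction refl q≢w
    high-pair (inj₁ refl) (inj₂ refl) _ (inj₂ refl) = inj₂ refl
    high-pair (inj₂ refl) (inj₂ refl) q≢w _ = contradiction refl q≢w
    high-pair (inj₂ refl) (inj₁ refl) _ (inj₁ refl) = inj₂ refl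

    nonface-linked : ∀ {i j k p q w} → NonfaceTriple i j k → OneOf p i j k → OneOf q i j k → OneOf w i j k →
                     p ≢ q → w ≢ p → w ≢ q → p ≢ v → q ≢ v → w ≢ v → Linked p q
    nonface-linked (consecutive i) p∈ q∈ _ _ _ _ _ _ _ =
      inj₁ (ℕ.≤-trans (proj₂ (range p∈)) (ℕ.+-monoʳ-≤ 2 (proj₁ (range q∈))) ,
            ℕ.≤-trans (proj₂ (range q∈)) (ℕ.+-monoʳ-≤ 2 (proj₁ (range p∈))))
      where
      range : ∀ {t} → OneOf t i (1 + i) (2 + i) → i ≤ t × t ≤ 2 + i
      range is₁ = ℕ.≤-refl , ℕ.m≤n+m i 2
      range is₂ = ℕ.n≤1+n i , ℕ.n≤1+n (1 + i)
      range is₃ = ℕ.m≤n+m i 2 , ℕ.≤-refl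
    nonface-linked (closing a≤1) (inj₁ refl) (inj₁ refl) _ p≢q _ _ _ _ _ = contradiction refl p≢q
    nonface-linked (closing a≤1) (inj₁ refl) (inj₂ hq) (inj₁ refl) _ w≢p _ _ _ _ = contradiction refl w≢p
    nonface-linked (closing a≤1) (inj₁ refl) (inj₂ hq) (inj₂ hw) _ _ w≢q _ q≢v w≢v =
      inj₂ (inj₁ (a≤1 , hq , λ hv → [ q≢v ∘ sym , w≢v ∘ sym ] (high-pair hq hw (w≢q ∘ sym) hv)))
    nonface-linked (closing a≤1) (inj₂ hp) (inj₁ refl) (inj₁ refl) _ _ w≢q _ _ _ = contradiction refl w≢q
    nonface-linked (closing a≤1) (inj₂ hp) (inj₁ refl) (inj₂ hw) _ w≢p _ p≢v _ w≢v =
      inj₂ (inj₂ (a≤1 , hp , λ hv → [ p≢v ∘ sym , w≢v ∘ sym ] (high-pair hp hw (w≢p ∘ sym) hv)))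
    nonface-linked (closing a≤1) (inj₂ hp) (inj₂ hq) _ _ _ _ _ _ _ = inj₁ (high-close hp hq)

    third-low : ∀ {p q r} → q ≢ r → p ≤ 1 → High q → Linked p r → Linked q r → ¬ NonfaceAmong p q r → r ≤ 1
    third-low _ _ _ (inj₂ (inj₂ (r≤1 , _))) _ _ = r≤1
    third-low {p} {q} {r} q≢r p≤1 hq (inj₂ (inj₁ (_ , hr , _))) _ ¬nonface =
      contradiction (p , 6 + L , 7 + L , closing p≤1 , is₁ , among (inj₁ refl) , among (inj₂ refl)) ¬nonface
      where
      among : ∀ {t} → High t → OneOf t p q r
      among ht = inj₂ (high-pair hq hr q≢r ht)
    third-low _ _ _ (inj₁ _) (inj₂ (inj₂ (r≤1 , _))) _ = r≤1
    third-low _ _ hq (inj₁ _) (inj₂ (inj₁ (q≤1 , _))) _ = contradiction hq (low-not-high q≤1)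
    third-low _ p≤1 hq (inj₁ (_ , r≤2+p)) (inj₁ (q≤2+r , _)) _ =
      contradiction (6+L≤high hq) (ℕ.<⇒≱ q<6+L)
      where
      q<6+L : _ < 6 + L
      q<6+L = ℕ.≤-trans (s≤s q≤2+r)
                (ℕ.≤-trans (ℕ.+-monoʳ-≤ 3 (ℕ.≤-trans r≤2+p (ℕ.+-monoʳ-≤ 2 p≤1))) (ℕ.m≤m+n 6 L))

    2≤third : ∀ {p r t} → p ≤ 1 → r ≤ 1 → p ≢ r → p ≢ t → r ≢ t → 2 ≤ t
    2≤third {t = zero} z≤n _ _ p≢t _ = contradiction refl p≢t
    2≤third {t = zero} (s≤s z≤n) z≤n _ _ r≢t = contradiction refl r≢t
    2≤third {t = zero} (s≤s z≤n) (s≤s z≤n) p≢r _ _ = contradiction refl p≢r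
    2≤third {t = suc zero} (s≤s z≤n) _ _ p≢t _ = contradiction refl p≢t
    2≤third {t = suc zero} z≤n (s≤s z≤n) _ _ r≢t = contradiction refl r≢t
    2≤third {t = suc zero} z≤n z≤n p≢r _ _ = contradiction refl p≢r
    2≤third {t = suc (suc t)} _ _ _ _ _ = s≤s (s≤s z≤n)

    v<6+L : ¬ High v → v < 6 + L
    v<6+L ¬hv = ℕ.≤∧≢⇒< (ℕ.≤-pred (ℕ.≤∧≢⇒< (ℕ.≤-pred v<N) (¬hv ∘ inj₂))) (¬hv ∘ inj₁)

    cross-top : ∀ {p q r} → p ≢ r → p ≢ v → r ≢ v → q ≢ r → Cross p q → Linked p r → Linked q r →
                ¬ NonfaceAmong p q r → Top q p r
    cross-top {p} {q} {r} p≢r p≢v r≢v q≢r (p≤1 , hq , ¬hv) pr qr ¬nonface =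
      ℕ.<-≤-trans (v<6+L ¬hv) (6+L≤high hq) , ℕ.<-≤-trans (s≤s p≤1) 2≤v , ℕ.<-≤-trans (s≤s r≤1) 2≤v
      where
      r≤1 : r ≤ 1
      r≤1 = third-low q≢r p≤1 hq pr qr ¬nonface
      2≤v : 2 ≤ v
      2≤v = 2≤third p≤1 r≤1 p≢r p≢v r≢v

    top-swap : ∀ {t a b} → Top t a b → Top t b a
    top-swap (v<t , a<v , b<v) = v<t , b<v , a<v

    linked-top : ∀ {x y z} → x ≢ y → x ≢ z → y ≢ z → x ≢ v → y ≢ v → z ≢ v →
                 Linked x y → Linked x z → Linked y z → ¬ NonfaceAmong x y z →
                 Top x y z ⊎ Top y x z ⊎ Top z x y
    linked-top x≢y x≢z y≢z x≢v y≢v z≢v (inj₂ (inj₁ c)) xz yz ¬nonface =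
      inj₂ (inj₁ (cross-top x≢z x≢v z≢v y≢z c xz yz ¬nonface))
    linked-top x≢y x≢z y≢z x≢v y≢v z≢v (inj₂ (inj₂ c)) xz yz ¬nonface =
      inj₁ (cross-top y≢z y≢v z≢v x≢z c yz xz (¬nonface ∘ nonfaceAmong-perm is₂ is₁ is₃))
    linked-top x≢y x≢z y≢z x≢v y≢v z≢v (inj₁ xy) (inj₂ (inj₁ c)) yz ¬nonface =
      inj₂ (inj₂ (cross-top x≢y x≢v y≢v (y≢z ∘ sym) c (inj₁ xy) (linked-sym yz)
                    (¬nonface ∘ nonfaceAmong-perm is₁ is₃ is₂)))
    linked-top x≢y x≢z y≢z x≢v y≢v z≢v (inj₁ xy) (inj₂ (inj₂ c)) yz ¬nonface =
      inj₁ (top-swap (cross-top (y≢z ∘ sym) z≢v y≢v x≢y c (linked-sym yz) (inj₁ xy)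
                        (¬nonface ∘ nonfaceAmong-perm is₃ is₁ is₂)))
    linked-top x≢y x≢z y≢z x≢v y≢v z≢v (inj₁ xy) (inj₁ xz) (inj₂ (inj₁ c)) ¬nonface =
      inj₂ (inj₂ (top-swap (cross-top (x≢y ∘ sym) y≢v x≢v (x≢z ∘ sym) c
                              (linked-sym (inj₁ xy)) (linked-sym (inj₁ xz))
                              (¬nonface ∘ nonfaceAmong-perm is₂ is₃ is₁))))
    linked-top x≢y x≢z y≢z x≢v y≢v z≢v (inj₁ xy) (inj₁ xz) (inj₂ (inj₂ c)) ¬nonface =
      inj₂ (inj₁ (top-swap (cross-top (x≢z ∘ sym) z≢v x≢v (x≢y ∘ sym) c
                              (linked-sym (inj₁ xz)) (linked-sym (inj₁ xy))
                              (¬nonface ∘ nonfaceAmong-perm is₃ is₂ is₁))))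
    linked-top x≢y x≢z y≢z _ _ _ (inj₁ xy) (inj₁ xz) (inj₁ yz) ¬nonface =
      contradiction (close-triple x≢y x≢z y≢z xy xz yz) ¬nonface

  module Restriction (v : Fin N) where

    open Links (toℕ v) (Fin.toℕ<n v)

    Avoids : Subset N → Set
    Avoids X = ∀ {w} → w ∈ X → w ≢ v

    Covered : Fin N → Fin N → Set
    Covered a b = ∃ λ c → c ≢ v × ContainsNonface (triple a b c)

    opaque
      covered? : ∀ a b → Dec (Covered a b)
      covered? a b = Fin.any? λ c → ¬? (c Fin.≟ v) ×-dec containsNonface? (triple a b c)

    PairEntry : Fin N → Fin N → Fin N → Set
    PairEntry a b w = ¬ Covered a b × w ∉ pair a b

    pairEntry? : ∀ a b w → Dec (PairEntry a b w)
    pairEntry? a b w = ¬? (covered? a b) ×-dec ¬? (w ∈? pair a b)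

    -- The rows are the complements of the flats ∅, {w < v} and the pairs not covered by a nonface
    -- avoiding v; rows are indexed by all pairs, and those of covered pairs are zero.
    R : ℕ
    R = 2 + N * N

    Entry : Fin R → Fin N → Set
    Entry Fin.zero w = ⊤
    Entry (Fin.suc Fin.zero) w = v Fin.≤ w
    Entry (Fin.suc (Fin.suc i)) w = PairEntry (proj₁ (Fin.remQuot {N} N i)) (proj₂ (Fin.remQuot {N} N i)) w

    entry? : ∀ ρ w → Dec (Entry ρ w)
    entry? Fin.zero w = yes tt
    entry? (Fin.suc Fin.zero) w = v Fin.≤? w
    entry? (Fin.suc (Fin.suc i)) w = pairEntry? (proj₁ (Fin.remQuot {N} N i)) (proj₂ (Fin.remQuot {N} N i)) w

    row : Fin R → Fin N → Bool
    row ρ w = ⌊ entry? ρ w ⌋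

    pairIndex : Fin N → Fin N → Fin R
    pairIndex a b = Fin.suc (Fin.suc (Fin.combine a b))

    entry-pairIndex : ∀ {a b w} → PairEntry a b w → Entry (pairIndex a b) w
    entry-pairIndex {a} {b} {w} =
      subst (λ ab → PairEntry (proj₁ ab) (proj₂ ab) w) (sym (Fin.remQuot-combine {N} {N} a b))

    entry-pairIndex⁻ : ∀ {a b w} → Entry (pairIndex a b) w → PairEntry a b w
    entry-pairIndex⁻ {a} {b} {w} =
      subst (λ ab → PairEntry (proj₁ ab) (proj₂ ab) w) (Fin.remQuot-combine {N} {N} a b)

    row-true : ∀ {ρ w} → Entry ρ w → row ρ w ≡ true
    row-true {ρ} {w} = ⇒⌊⌋≡true (entry? ρ w)

    row-false : ∀ {ρ w} → ¬ Entry ρ w → row ρ w ≡ false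
    row-false {ρ} {w} = ⇒⌊⌋≡false (entry? ρ w)

    open Triangularity row

    nonface-not-isolated-by-pair-row : ∀ {X x a b} → Avoids X → ContainsNonface X → x ∈ X →
                                       PairEntry a b x → (∀ w → w ∈ X - x → ¬ PairEntry a b w) → ⊥
    nonface-not-isolated-by-pair-row {X} {x} {a} {b} avoids nonface x∈X (¬covered , _) ¬entry =
      ¬covered (x , avoids x∈X , containsNonface-⊆ X⊆abx nonface)
      where
      X⊆abx : X ⊆ triple a b x
      X⊆abx {w} w∈X with w Fin.≟ x | w ∈? pair a b
      ... | yes refl | _ = z∈triple a b x
      ... | no _ | yes w∈ab = [ (λ { refl → x∈triple a b x }) , (λ { refl → y∈triple a b x }) ] (∈-pair⁻ w∈ab)
      ... | no w≢x | no w∉ab = contradiction (¬covered , w∉ab) (¬entry w (x∈p∧x≢y⇒x∈p-y w∈X w≢x))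

    nonface-not-isolated-by-threshold-row : ∀ {X x} → ∣ X ∣ ≤ 3 → Avoids X → ContainsNonface X → x ∈ X →
                                            v Fin.≤ x → (∀ w → w ∈ X - x → ¬ v Fin.≤ w) → ⊥
    nonface-not-isolated-by-threshold-row {X} {x} ∣X∣≤3 avoids (a , b , c , nf , a∈ , b∈ , c∈) x∈X v≤x ¬v≤ =
      top-element (c Fin.≟ x)
      where
      a<b : toℕ a < toℕ b
      a<b = proj₁ (nonfaceTriple-ordered nf)
      c≡1+b : toℕ c ≡ suc (toℕ b)
      c≡1+b = proj₂ (nonfaceTriple-ordered nf)
      b<c : toℕ b < toℕ c
      b<c = ℕ.<-≤-trans (ℕ.n<1+n _) (ℕ.≤-reflexive (sym c≡1+b))
      v<x : toℕ v < toℕ x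
      v<x = ℕ.≤∧≢⇒< v≤x (λ v≡x → avoids x∈X (sym (Fin.toℕ-injective v≡x)))
      minus : ∀ {u} → u ∈ X → u ≢ x → u ∈ X - x
      minus = x∈p∧x≢y⇒x∈p-y
      below : ∀ {w} → w ∈ X → w ≢ x → toℕ w < toℕ v
      below w∈ w≢x = ℕ.≰⇒> (¬v≤ _ (minus w∈ w≢x))
      top-element : Dec (c ≡ x) → ⊥
      top-element (yes c≡x) =
        ℕ.<⇒≱ (below b∈ (λ b≡x → ℕ.<-irrefl (cong toℕ (trans b≡x (sym c≡x))) b<c))
          (ℕ.≤-pred (subst (toℕ v <_) (trans (cong toℕ (sym c≡x)) c≡1+b) v<x))
      top-element (no c≢x) =
        ¬containsNonface-minus ∣X∣≤3 x∈X (a , b , c , nf , minus a∈ (≢x a<c) , minus b∈ (≢x b<c) , minus c∈ c≢x)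
        where
        c<v : toℕ c < toℕ v
        c<v = below c∈ c≢x
        a<c : toℕ a < toℕ c
        a<c = ℕ.<-trans a<b b<c
        ≢x : ∀ {u} → toℕ u < toℕ c → u ≢ x
        ≢x u<c u≡x = ℕ.<-asym v<x (subst (_< toℕ v) (cong toℕ u≡x) (ℕ.<-trans u<c c<v))

    nonface-not-isolated : ∀ {X x} ρ → ∣ X ∣ ≤ 3 → Avoids X → ContainsNonface X → x ∈ X →
                           Entry ρ x → (∀ w → w ∈ X - x → ¬ Entry ρ w) → ⊥
    nonface-not-isolated {X} {x} Fin.zero _ _ (a , b , _ , nf , a∈ , b∈ , _) _ _ ¬entry with a Fin.≟ x
    ... | yes refl = ¬entry b (x∈p∧x≢y⇒x∈p-y b∈ (proj₁ (isNonface-distinct nf) ∘ sym)) tt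
    ... | no a≢x = ¬entry a (x∈p∧x≢y⇒x∈p-y a∈ a≢x) tt
    nonface-not-isolated (Fin.suc Fin.zero) = nonface-not-isolated-by-threshold-row
    nonface-not-isolated (Fin.suc (Fin.suc i)) _ = nonface-not-isolated-by-pair-row

    triangular⇒face : ∀ {Y} → Avoids Y → ∣ Y ∣ ≤ 3 → Triangular row Y → Δ Y ≡ true
    triangular⇒face avoids ∣Y∣≤3 t = Δ-face⁺ ∣Y∣≤3 λ nonface@(a , _ , _ , _ , a∈ , _) →
      let x , x∈Y , ρ , ρx , zeros = isolated-pivot t (a , a∈) in
      nonface-not-isolated ρ ∣Y∣≤3 avoids nonface x∈Y (⌊⌋≡true⇒ (entry? ρ x) ρx)
        (λ w w∈ → ⌊⌋≡false⇒ (entry? ρ w) (zeros w w∈))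

    extend : ∀ {ρ x Y} → Entry ρ x → (∀ w → w ∈ Y → ¬ Entry ρ w) → Triangular row Y → Triangular row (⁅ x ⁆ ∪ Y)
    extend x∈ρ Y∉ρ t = triangular-⁅⁆∪ t (row-true x∈ρ) λ w w∈Y → row-false (Y∉ρ w w∈Y)

    extend-by-pair-row : ∀ {a b x Y} → ¬ Covered a b → x ∉ pair a b → Y ⊆ pair a b →
                         Triangular row Y → Triangular row (⁅ x ⁆ ∪ Y)
    extend-by-pair-row {a} {b} ¬covered x∉ab Y⊆ab =
      extend {ρ = pairIndex a b} (entry-pairIndex (¬covered , x∉ab)) λ w w∈Y entry →
        proj₂ (entry-pairIndex⁻ {a} {b} entry) (Y⊆ab w∈Y)

    singleton-triangular : ∀ x → Triangular row ⁅ x ⁆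
    singleton-triangular x =
      subst (Triangular row) (∪-identityʳ ⁅ x ⁆)
        (extend {ρ = Fin.zero} tt (λ w w∈∅ → ⊥-elim (∉⊥ w∈∅)) (triangular-empty λ (_ , w∈∅) → ∉⊥ w∈∅))

    ¬covered-same : ∀ y → ¬ Covered y y
    ¬covered-same y (c , _ , nonface) =
      proj₁ (3≤∣triple∣⇒distinct {x = y} {y} {c} (containsNonface⇒3≤∣X∣ nonface)) refl

    pair-triangular : ∀ {x y} → x ≢ y → Triangular row (pair x y)
    pair-triangular {x} {y} x≢y =
      extend-by-pair-row (¬covered-same y) (λ x∈yy → x≢y ([ id , id ]′ (∈-pair⁻ x∈yy)))
        (λ w∈y → x∈p∪q⁺ (inj₁ w∈y)) (singleton-triangular y)

    pair-separated : ∀ {x y z} → x ≢ y → x ≢ z → y ≢ z → ¬ Covered y z → Triangular row (triple x y z)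
    pair-separated x≢y x≢z y≢z ¬covered =
      extend-by-pair-row ¬covered (λ x∈yz → [ x≢y , x≢z ]′ (∈-pair⁻ x∈yz)) id (pair-triangular y≢z)

    top-triangular : ∀ {t o₁ o₂} → o₁ ≢ o₂ → Top (toℕ t) (toℕ o₁) (toℕ o₂) → Triangular row (triple t o₁ o₂)
    top-triangular {t} {o₁} {o₂} o₁≢o₂ (v<t , o₁<v , o₂<v) =
      extend {ρ = Fin.suc Fin.zero} (ℕ.<⇒≤ v<t) not-above (pair-triangular o₁≢o₂)
      where
      not-above : ∀ w → w ∈ pair o₁ o₂ → ¬ v Fin.≤ w
      not-above w w∈ with ∈-pair⁻ w∈
      ... | inj₁ refl = ℕ.<⇒≱ o₁<v
      ... | inj₂ refl = ℕ.<⇒≱ o₂<v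

    ≢toℕ : ∀ {x y : Fin N} → x ≢ y → toℕ x ≢ toℕ y
    ≢toℕ x≢y = x≢y ∘ Fin.toℕ-injective

    toℕ-oneOf : ∀ {w a b c : Fin N} → w ≡ a ⊎ w ≡ b ⊎ w ≡ c → OneOf (toℕ w) (toℕ a) (toℕ b) (toℕ c)
    toℕ-oneOf = Sum.map (cong toℕ) (Sum.map (cong toℕ) (cong toℕ))

    covered⇒linked : ∀ {a b} → a ≢ v → b ≢ v → Covered a b → Linked (toℕ a) (toℕ b)
    covered⇒linked {a} {b} a≢v b≢v (c , c≢v , nonface@(a′ , b′ , c′ , nf , a′∈ , b′∈ , c′∈)) =
      nonface-linked nf (value (x∈triple a b c)) (value (y∈triple a b c)) (value (z∈triple a b c))
        (≢toℕ a≢b) (≢toℕ (a≢c ∘ sym)) (≢toℕ (b≢c ∘ sym)) (≢toℕ a≢v) (≢toℕ b≢v) (≢toℕ c≢v)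
      where
      distinct : a ≢ b × a ≢ c × b ≢ c
      distinct = 3≤∣triple∣⇒distinct (containsNonface⇒3≤∣X∣ nonface)
      a≢b : a ≢ b
      a≢b = proj₁ distinct
      a≢c : a ≢ c
      a≢c = proj₁ (proj₂ distinct)
      b≢c : b ≢ c
      b≢c = proj₂ (proj₂ distinct)
      value : ∀ {w} → w ∈ triple a b c → OneOf (toℕ w) (toℕ a′) (toℕ b′) (toℕ c′)
      value w∈ = toℕ-oneOf (nonface-covers (∣triple∣≤3 a b c) nf a′∈ b′∈ c′∈ w∈)

    nonfaceAmong⇒containsNonface : ∀ {x y z} → NonfaceAmong (toℕ x) (toℕ y) (toℕ z) →
                                   ContainsNonface (triple x y z)
    nonfaceAmong⇒containsNonface {x} {y} {z} (i , j , k , nf , i∈ , j∈ , k∈) =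
      let a , a∈ , a≡ = pick i∈ ; b , b∈ , b≡ = pick j∈ ; c , c∈ , c≡ = pick k∈ in
      a , b , c , isNonface a≡ b≡ c≡ nf , a∈ , b∈ , c∈
      where
      pick : ∀ {t} → OneOf t (toℕ x) (toℕ y) (toℕ z) → ∃ λ w → w ∈ triple x y z × toℕ w ≡ t
      pick (inj₁ t≡x) = x , x∈triple x y z , sym t≡x
      pick (inj₂ (inj₁ t≡y)) = y , y∈triple x y z , sym t≡y
      pick (inj₂ (inj₂ t≡z)) = z , z∈triple x y z , sym t≡z

    face-triple-triangular : ∀ {x y z} → x ≢ y → x ≢ z → y ≢ z → x ≢ v → y ≢ v → z ≢ v →
                             ¬ ContainsNonface (triple x y z) → Triangular row (triple x y z)
    face-triple-triangular {x} {y} {z} x≢y x≢z y≢z x≢v y≢v z≢v ¬nonface =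
      by-covering (covered? y z) (covered? x z) (covered? x y)
      where
      by-top : Top (toℕ x) (toℕ y) (toℕ z) ⊎ Top (toℕ y) (toℕ x) (toℕ z) ⊎ Top (toℕ z) (toℕ x) (toℕ y) →
               Triangular row (triple x y z)
      by-top (inj₁ top) = top-triangular y≢z top
      by-top (inj₂ (inj₁ top)) = subst (Triangular row) (triple-swap x y z) (top-triangular x≢z top)
      by-top (inj₂ (inj₂ top)) = subst (Triangular row) (triple-rotate x y z) (top-triangular x≢y top)
      by-covering : Dec (Covered y z) → Dec (Covered x z) → Dec (Covered x y) → Triangular row (triple x y z)
      by-covering (no ¬yz) _ _ = pair-separated x≢y x≢z y≢z ¬yz
      by-covering (yes _) (no ¬xz) _ =
        subst (Triangular row) (triple-swap x y z) (pair-separated (x≢y ∘ sym) y≢z x≢z ¬xz)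
      by-covering (yes _) (yes _) (no ¬xy) =
        subst (Triangular row) (triple-rotate x y z) (pair-separated (x≢z ∘ sym) (y≢z ∘ sym) x≢y ¬xy)
      by-covering (yes yz) (yes xz) (yes xy) =
        by-top (linked-top (≢toℕ x≢y) (≢toℕ x≢z) (≢toℕ y≢z) (≢toℕ x≢v) (≢toℕ y≢v) (≢toℕ z≢v)
                  (covered⇒linked x≢v y≢v xy) (covered⇒linked x≢v z≢v xz) (covered⇒linked y≢v z≢v yz)
                  (¬nonface ∘ nonfaceAmong⇒containsNonface))

    face⇒triangular : ∀ {Y} → Avoids Y → Δ Y ≡ true → Triangular row Y
    face⇒triangular {Y} avoids ΔY = by-size ∣ Y ∣ refl (proj₁ (Δ-face⁻ ΔY))
      where
      by-size : ∀ c → ∣ Y ∣ ≡ c → c ≤ 3 → Triangular row Y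
      by-size 0 ∣Y∣≡0 _ = triangular-empty (∣p∣≡0⇒Empty Y ∣Y∣≡0)
      by-size 1 ∣Y∣≡1 _ =
        let x , Y≡x = ∣p∣≡1⇒singleton Y ∣Y∣≡1 in subst (Triangular row) (sym Y≡x) (singleton-triangular x)
      by-size 2 ∣Y∣≡2 _ =
        let x , y , x≢y , Y≡xy = ∣p∣≡2⇒pair Y ∣Y∣≡2 in subst (Triangular row) (sym Y≡xy) (pair-triangular x≢y)
      by-size 3 ∣Y∣≡3 _ =
        let x , y , z , x≢y , x≢z , y≢z , Y≡xyz = ∣p∣≡3⇒triple Y ∣Y∣≡3
            avoids′ = λ {w} (w∈ : w ∈ triple x y z) → avoids (subst (w ∈_) (sym Y≡xyz) w∈)
        in subst (Triangular row) (sym Y≡xyz)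
             (face-triple-triangular x≢y x≢z y≢z (avoids′ (x∈triple x y z)) (avoids′ (y∈triple x y z))
               (avoids′ (z∈triple x y z)) (subst (¬_ ∘ ContainsNonface) Y≡xyz (proj₂ (Δ-face⁻ ΔY))))
      by-size (suc (suc (suc (suc _)))) _ (s≤s (s≤s (s≤s ())))

    restriction-inTBP2 : ∀ {k} {f : Fin k → Fin N} → Injective _≡_ _≡_ f → (∀ u → f u ≢ v) →
                         InTBP2 (restrictAlong f Δ)
    restriction-inTBP2 {k} {f} f-inj missed =
      restrictAlong-isSC f Δ-isSC , dim≤2 , paving dim≤2 small-faces ,
      truncation-isTBRSC (λ ρ → row ρ ∘ f) (s≤s z≤n) singletons-triangular faces⇔
      where
      avoids : ∀ X → Avoids (image f X)
      avoids X w∈ with ∈-image⁻ f w∈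
      ... | u , _ , refl = missed u
      ∣fX∣≡∣X∣ : ∀ X → ∣ image f X ∣ ≡ ∣ X ∣
      ∣fX∣≡∣X∣ = ∣image∣ f-inj
      dim≤2 : DimLe2 (restrictAlong f Δ)
      dim≤2 X ΔfX = subst (_≤ 3) (∣fX∣≡∣X∣ X) (proj₁ (Δ-face⁻ ΔfX))
      small-faces : ∀ X → ∣ X ∣ ≤ 2 → Δ (image f X) ≡ true
      small-faces X ∣X∣≤2 = Δ-small (subst (_≤ 2) (sym (∣fX∣≡∣X∣ X)) ∣X∣≤2)
      faces⇔ : ∀ X → (Δ (image f X) ≡ true) ⇔ (Triangular (λ ρ → row ρ ∘ f) X × ∣ X ∣ ≤ 3)
      faces⇔ X = mk⇔
        (λ ΔfX → triangular-image⁻ row f-inj (face⇒triangular (avoids X) ΔfX) , dim≤2 X ΔfX)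
        (λ (t , ∣X∣≤3) →
          triangular⇒face (avoids X) (subst (_≤ 3) (sym (∣fX∣≡∣X∣ X)) ∣X∣≤3) (triangular-image⁺ row f-inj t))
      singletons-triangular : ∀ u → Triangular (λ ρ → row ρ ∘ f) ⁅ u ⁆
      singletons-triangular u =
        proj₁ (Equivalence.to (faces⇔ ⁅ u ⁆)
                 (small-faces ⁅ u ⁆ (ℕ.≤-trans (ℕ.≤-reflexive (∣⁅x⁆∣≡1 u)) (s≤s z≤n))))

theorem6p4 : ¬ (Σ ℕ λ m → 1 ≤ m ×
                 (∀ (n : ℕ) (F : Faces (suc n)) → IsSC F → ¬ InTBP2 F →
                   Σ ℕ λ k → suc k ≤ m × Σ (Fin (suc k) → Fin (suc n)) λ f →
                     Injective _≡_ _≡_ f × ¬ InTBP2 (restrictAlong f F)))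
theorem6p4 (m , _ , small-witness) =
  let k , 1+k≤m , f , f-inj , ¬restriction-in-TBP2 = small-witness (7 + m) Δ Δ-isSC Δ-not-in-TBP2
      v , missed = missing-vertex (ℕ.≤-trans (s≤s 1+k≤m) (s≤s (ℕ.m≤n+m m 7))) f
  in ¬restriction-in-TBP2 (Restriction.restriction-inTBP2 v f-inj missed)
  where
  open Counterexample m
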